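{- Let $2\le d<n$ be integers and let $a,b$ be integers with $1\le a\le n$ and $1\le b\le\binom{n}{d}$. Let $M_1\in\operatorname{ple}(b,a)$. If $M_1$ is not maximal-preserving, then there exists $M_2\in\operatorname{ple}(b,a)$ with $q(M_2)=q(M_1)+1$.
   Context: $P=P(1,d;n)$ is the poset consisting of all $1$-element and $d$-element subsets of $\{1,\dots,n\}$ ordered by inclusion; its minimal elements are identified with the integers $1,\dots,n$, so $u<S$ in $P$ iff $u\in S$. A partial linear extension (ple) of $P$ is a linear extension of a subposet of $P$ (possibly $P$ itself). For a ple $M$: $a(M)$ is the number of minimal elements of $P$ in $M$; $b(M)$ is the number of maximal elements of $P$ in $M$; $q(M)$ is the number of pairs $(u,S)$ with $u$ a minimal and $S$ a maximal element of $P$, both in $M$, such that $u<S$ in $M$ (regardless of whether $u\in S$). $\operatorname{ple}(b,a)$ is the set of ple's $M$ with $a(M)=a$ and $b(M)=b$. A ple $M\in\operatorname{ple}(b,a)$ is maximal-preserving if there is no $M'\in\operatorname{ple}(b,a)$ with $q(M')>q(M)$. -}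

module Defs where

open import Data.Nat using (ℕ; zero; suc; _+_; _<_)
open import Data.Fin using (Fin)
open import Data.Fin.Subset using (Subset; _∈_; ∣_∣)
open import Data.List using (List; []; _∷_)
open import Data.List.Relation.Unary.All using (All)
open import Data.List.Relation.Unary.Unique.Propositional using (Unique)
open import Data.Product using (Σ; _×_)
open import Data.Unit using (⊤)
open import Relation.Binary.PropositionalEquality using (_≡_)
open import Relation.Nullary using (¬_)

-- Elements of P(1,d;n): minimal elements are the integers (Fin n);
-- maximal elements are subsets S of {1..n} (required to have size d
-- by the predicate ValidElem below).
data Elem (n : ℕ) : Set where
  mn : Fin n → Elem n
  mx : Subset n → Elem n

ValidElem : {n : ℕ} → ℕ → Elem n → Set
ValidElem d (mn u) = ⊤
ValidElem d (mx S) = ∣ S ∣ ≡ d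

data _<P_ {n : ℕ} : Elem n → Elem n → Set where
  min<max : ∀ {u S} → u ∈ S → mn u <P mx S

Compatible : {n : ℕ} → List (Elem n) → Set
Compatible [] = ⊤
Compatible (x ∷ xs) = All (λ y → ¬ (y <P x)) xs × Compatible xs

-- A partial linear extension of P(1,d;n): a linear ordering (list of
-- distinct elements, first = smallest) of a subset of P that extends
-- the induced order of P.
IsPle : (n d : ℕ) → List (Elem n) → Set
IsPle n d M = Unique M × All (ValidElem d) M × Compatible M

aM : {n : ℕ} → List (Elem n) → ℕ
aM [] = 0
aM (mn _ ∷ xs) = suc (aM xs)
aM (mx _ ∷ xs) = aM xs

bM : {n : ℕ} → List (Elem n) → ℕ
bM [] = 0
bM (mn _ ∷ xs) = bM xs
bM (mx _ ∷ xs) = suc (bM xs)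

-- q(M): number of pairs (u,S), u minimal, S maximal, both in M, with
-- u before S in M (regardless of whether u ∈ S).
qM : {n : ℕ} → List (Elem n) → ℕ
qM [] = 0
qM (mn _ ∷ xs) = bM xs + qM xs
qM (mx _ ∷ xs) = qM xs

InPle : (n d b a : ℕ) → List (Elem n) → Set
InPle n d b a M = IsPle n d M × aM M ≡ a × bM M ≡ b

MaxPreserving : (n d b a : ℕ) → List (Elem n) → Set
MaxPreserving n d b a M = ¬ (Σ (List (Elem n)) λ M' → InPle n d b a M' × qM M < qM M')

{-# OPTIONS --safe #-}
module Submission where

open import Defs
open import Data.Nat using (ℕ; suc; _≤_; _<_; _+_; _*_)
open import Data.Nat.Properties using (≤-refl; ≤-trans; <-irrefl; <-≤-trans; +-suc; +-monoʳ-≤; *-monoʳ-≤; n≤1+n)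
open import Data.Nat.Combinatorics using (_C_)
open import Data.List using (List; []; _∷_)
open import Data.List.Relation.Unary.All using (All; []; _∷_)
open import Data.List.Relation.Unary.AllPairs using (_∷_)
open import Data.List.Relation.Unary.Unique.Propositional using (Unique)
open import Data.Product using (Σ; _×_; _,_)
open import Data.Sum using (_⊎_; inj₁; inj₂)
open import Data.Empty using (⊥-elim)
open import Relation.Binary.PropositionalEquality using (_≡_; refl; sym; trans; cong; cong₂; ≢-sym)
open import Relation.Nullary using (¬_)

-- Moving a minimal element one step left past an adjacent maximal
-- element keeps a ple a ple (no minimal element lies above a maximal one, so
-- the move never violates the order of P), keeps a and b, and raises q by
-- exactly one.  If no maximal element is immediately followed by a minimal one,
-- all minimal elements precede all maximal ones, so q = a·b, which is an upper
-- bound for q on ple(b,a); then M₁ would be maximal-preserving.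

data Swap {n : ℕ} : List (Elem n) → List (Elem n) → Set where
  here  : ∀ {S u xs} → Swap (mx S ∷ mn u ∷ xs) (mn u ∷ mx S ∷ xs)
  there : ∀ {x xs ys} → Swap xs ys → Swap (x ∷ xs) (x ∷ ys)

Swap-All : ∀ {n} {P : Elem n → Set} {xs ys} → Swap xs ys → All P xs → All P ys
Swap-All here      (p ∷ q ∷ ps) = q ∷ p ∷ ps
Swap-All (there s) (p ∷ ps)     = p ∷ Swap-All s ps

Swap-Unique : ∀ {n} {xs ys : List (Elem n)} → Swap xs ys → Unique xs → Unique ys
Swap-Unique here      ((S≢u ∷ S∉xs) ∷ u∉xs ∷ u) = (≢-sym S≢u ∷ u∉xs) ∷ S∉xs ∷ u
Swap-Unique (there s) (x∉xs ∷ u)                = Swap-All s x∉xs ∷ Swap-Unique s u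

Swap-Compatible : ∀ {n} {xs ys : List (Elem n)} → Swap xs ys → Compatible xs → Compatible ys
Swap-Compatible here      ((_ ∷ S-ok) , u-ok , c) = ((λ ()) ∷ u-ok) , S-ok , c
Swap-Compatible (there s) (x-ok , c)              = Swap-All s x-ok , Swap-Compatible s c

Swap-aM : ∀ {n} {xs ys : List (Elem n)} → Swap xs ys → aM ys ≡ aM xs
Swap-aM here                  = refl
Swap-aM (there {x = mn _} s) = cong suc (Swap-aM s)
Swap-aM (there {x = mx _} s) = Swap-aM s

Swap-bM : ∀ {n} {xs ys : List (Elem n)} → Swap xs ys → bM ys ≡ bM xs
Swap-bM here                  = refl
Swap-bM (there {x = mn _} s) = Swap-bM s
Swap-bM (there {x = mx _} s) = cong suc (Swap-bM s)

Swap-qM : ∀ {n} {xs ys : List (Elem n)} → Swap xs ys → qM ys ≡ suc (qM xs)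
Swap-qM here = refl
Swap-qM (there {x = mn _} {xs} s) =
  trans (cong₂ _+_ (Swap-bM s) (Swap-qM s)) (+-suc (bM xs) (qM xs))
Swap-qM (there {x = mx _} s) = Swap-qM s

Swap-InPle : ∀ {n d b a} {xs ys : List (Elem n)} → Swap xs ys →
             InPle n d b a xs → InPle n d b a ys
Swap-InPle s ((u , v , c) , ea , eb) =
  (Swap-Unique s u , Swap-All s v , Swap-Compatible s c) ,
  trans (Swap-aM s) ea , trans (Swap-bM s) eb

qM≤aM*bM : ∀ {n} (xs : List (Elem n)) → qM xs ≤ aM xs * bM xs
qM≤aM*bM []          = ≤-refl
qM≤aM*bM (mn _ ∷ xs) = +-monoʳ-≤ (bM xs) (qM≤aM*bM xs)
qM≤aM*bM (mx _ ∷ xs) = ≤-trans (qM≤aM*bM xs) (*-monoʳ-≤ (aM xs) (n≤1+n _))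

InPle⇒qM≤a*b : ∀ {n d b a} {M : List (Elem n)} → InPle n d b a M → qM M ≤ a * b
InPle⇒qM≤a*b {M = M} (_ , refl , refl) = qM≤aM*bM M

qM≡aM*bM⇒MaxPreserving : ∀ {n d b a} {M : List (Elem n)} → InPle n d b a M →
                         qM M ≡ aM M * bM M → MaxPreserving n d b a M
qM≡aM*bM⇒MaxPreserving (_ , refl , refl) q≡ab (M′ , M′∈ple , q<q′) =
  <-irrefl q≡ab (<-≤-trans q<q′ (InPle⇒qM≤a*b M′∈ple))

aM≡0⇒qM≡0 : ∀ {n} (xs : List (Elem n)) → aM xs ≡ 0 → qM xs ≡ 0
aM≡0⇒qM≡0 []          _ = refl
aM≡0⇒qM≡0 (mx _ ∷ xs) e = aM≡0⇒qM≡0 xs e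

swap-or-aM≡0 : ∀ {n} S (xs : List (Elem n)) →
               (Σ (List (Elem n)) λ ys → Swap (mx S ∷ xs) ys) ⊎ aM xs ≡ 0
swap-or-aM≡0 S []          = inj₂ refl
swap-or-aM≡0 S (mn u ∷ xs) = inj₁ (_ , here)
swap-or-aM≡0 S (mx T ∷ xs) with swap-or-aM≡0 T xs
... | inj₁ (ys , s) = inj₁ (mx S ∷ ys , there s)
... | inj₂ e        = inj₂ e

swap-or-qM≡aM*bM : ∀ {n} (xs : List (Elem n)) →
                   (Σ (List (Elem n)) λ ys → Swap xs ys) ⊎ qM xs ≡ aM xs * bM xs
swap-or-qM≡aM*bM [] = inj₂ refl
swap-or-qM≡aM*bM (mn u ∷ xs) with swap-or-qM≡aM*bM xs
... | inj₁ (ys , s) = inj₁ (mn u ∷ ys , there s)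
... | inj₂ e        = inj₂ (cong (bM xs +_) e)
swap-or-qM≡aM*bM (mx S ∷ xs) with swap-or-aM≡0 S xs
... | inj₁ r = inj₁ r
... | inj₂ e = inj₂ (trans (aM≡0⇒qM≡0 xs e) (sym (cong (_* suc (bM xs)) e)))

lemma3p5 : (n d a b : ℕ) → 2 ≤ d → d < n → 1 ≤ a → a ≤ n → 1 ≤ b → b ≤ n C d →
    (M₁ : List (Elem n)) → InPle n d b a M₁ → ¬ MaxPreserving n d b a M₁ →
    Σ (List (Elem n)) λ M₂ → InPle n d b a M₂ × qM M₂ ≡ suc (qM M₁)
lemma3p5 n d a b _ _ _ _ _ _ M₁ M₁∈ple notMax with swap-or-qM≡aM*bM M₁
... | inj₁ (M₂ , s) = M₂ , Swap-InPle s M₁∈ple , Swap-qM s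
... | inj₂ q≡ab     = ⊥-elim (notMax (qM≡aM*bM⇒MaxPreserving M₁∈ple q≡ab))
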